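{- There is a finitely generated structure which has no d-$\Sigma^0_2$ Scott sentence but which has a d-$\Sigma^0_2$ quasi Scott sentence.
   Context: Formulas are in $\mathcal{L}_{\omega_1\omega}$ with the hierarchy: $\Sigma^0_0=\Pi^0_0$ = finitary quantifier-free; $\Sigma^0_\alpha$ = countable disjunctions of $\exists\bar x\,\phi$ with $\phi\in\Pi^0_\beta$, $\beta<\alpha$; $\Pi^0_\alpha$ = countable conjunctions of $\forall\bar x\,\phi$ with $\phi\in\Sigma^0_\beta$, $\beta<\alpha$; d-$\Sigma^0_\alpha$ = conjunction of a $\Sigma^0_\alpha$ and a $\Pi^0_\alpha$ formula. A Scott sentence for a countable structure is an $\mathcal{L}_{\omega_1\omega}$ sentence whose only countable model up to isomorphism is that structure; a quasi Scott sentence for a finitely generated structure is an $\mathcal{L}_{\omega_1\omega}$ sentence whose only finitely generated model up to isomorphism is that structure. -}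

module Defs where

open import Level using (0ℓ)
open import Data.Nat using (ℕ; zero; suc; _+_; _≤_)
open import Data.Fin using (Fin)
open import Data.Vec using (Vec; _++_; lookup; map)
open import Data.Bool using (Bool; true)
open import Data.Product using (Σ; Σ-syntax; ∃; ∃-syntax; _×_; _,_)
open import Data.Sum using (_⊎_)
open import Data.Empty using (⊥)
open import Data.Unit using (⊤)
open import Relation.Nullary using (¬_)
open import Relation.Binary.PropositionalEquality using (_≡_)
open import Function.Bundles using (_↣_; _⤖_; _⇔_; Bijection)
open import Function using (Injective)

record Signature : Set₁ where
  field
    FunSym     : Set
    funArity   : FunSym → ℕ
    RelSym     : Set
    relArity   : RelSym → ℕ
    funCountable : FunSym ↣ ℕ
    relCountable : RelSym ↣ ℕ

module _ (L : Signature) where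
  open Signature L

  -- Structures (equality is interpreted as true equality)

  record Structure : Set₁ where
    field
      Carrier : Set
      funI    : (f : FunSym) → Vec Carrier (funArity f) → Carrier
      relI    : (R : RelSym) → Vec Carrier (relArity R) → Set

  data Term (k : ℕ) : Set where
    var : Fin k → Term k
    app : (f : FunSym) → Vec (Term k) (funArity f) → Term k

  data QF (k : ℕ) : Set where
    qtrue qfalse : QF k
    eq   : Term k → Term k → QF k
    rel  : (R : RelSym) → Vec (Term k) (relArity R) → QF k
    neg  : QF k → QF k
    conj : QF k → QF k → QF k
    disj : QF k → QF k → QF k

  -- A countable disjunction (conjunction) is indexed by
  -- the subset {i | I i ≡ true} of ℕ (so it may be finite or empty);
  -- the i-th member is  ∃ x̄ φ i  (resp. ∀ x̄ φ i) with x̄ a block of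
  -- m i variables and φ i ∈ Π^0_{β i} (resp. Σ^0_{β i}) with β i < n+1.

  data Σf : ℕ → ℕ → Set
  data Πf : ℕ → ℕ → Set

  data Σf where
    qfΣ : ∀ {k} → QF k → Σf zero k
    ⋁∃  : ∀ {n k} (I : ℕ → Bool) (β : ℕ → ℕ) (β≤ : ∀ i → β i ≤ n)
          (m : ℕ → ℕ) (φ : (i : ℕ) → Πf (β i) (m i + k)) → Σf (suc n) k

  data Πf where
    qfΠ : ∀ {k} → QF k → Πf zero k
    ⋀∀  : ∀ {n k} (I : ℕ → Bool) (β : ℕ → ℕ) (β≤ : ∀ i → β i ≤ n)
          (m : ℕ → ℕ) (φ : (i : ℕ) → Σf (β i) (m i + k)) → Πf (suc n) k

  record DSigmaSentence (n : ℕ) : Set where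
    constructor _∧d_
    field
      sigmaPart : Σf n zero
      piPart    : Πf n zero

  module _ (M : Structure) where
    open Structure M

    eval : ∀ {k} → Term k → Vec Carrier k → Carrier
    evals : ∀ {k n} → Vec (Term k) n → Vec Carrier k → Vec Carrier n
    eval (var x) e = lookup e x
    eval (app f ts) e = funI f (evals ts e)
    evals Vec.[] e = Vec.[]
    evals (t Vec.∷ ts) e = eval t e Vec.∷ evals ts e

    satQF : ∀ {k} → QF k → Vec Carrier k → Set
    satQF qtrue e = ⊤
    satQF qfalse e = ⊥
    satQF (eq t s) e = eval t e ≡ eval s e
    satQF (rel R ts) e = relI R (evals ts e)
    satQF (neg φ) e = ¬ satQF φ e
    satQF (conj φ ψ) e = satQF φ e × satQF ψ e
    satQF (disj φ ψ) e = satQF φ e ⊎ satQF ψ e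

    satΣ : ∀ {n k} → Σf n k → Vec Carrier k → Set
    satΠ : ∀ {n k} → Πf n k → Vec Carrier k → Set
    satΣ (qfΣ φ) e = satQF φ e
    satΣ (⋁∃ I β β≤ m φ) e =
      Σ[ i ∈ ℕ ] (I i ≡ true × Σ[ a ∈ Vec Carrier (m i) ] satΠ (φ i) (a ++ e))
    satΠ (qfΠ φ) e = satQF φ e
    satΠ (⋀∀ I β β≤ m φ) e =
      (i : ℕ) → I i ≡ true → (a : Vec Carrier (m i)) → satΣ (φ i) (a ++ e)

    _⊨d_ : ∀ {n} → DSigmaSentence n → Set
    _⊨d_ (σ ∧d π) = satΣ σ Vec.[] × satΠ π Vec.[]

    Countable : Set
    Countable = Σ[ h ∈ (Carrier → ℕ) ] Injective _≡_ _≡_ h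

    FinitelyGenerated : Set
    FinitelyGenerated =
      Σ[ k ∈ ℕ ] Σ[ g ∈ Vec Carrier k ] ((x : Carrier) → Σ[ t ∈ Term k ] eval t g ≡ x)

  record _≅_ (M N : Structure) : Set where
    open Structure M renaming (Carrier to |M|; funI to fM; relI to rM)
    open Structure N renaming (Carrier to |N|; funI to fN; relI to rN)
    field
      bij      : |M| ⤖ |N|
    to : |M| → |N|
    to = Bijection.to bij
    field
      presFun : ∀ f (as : Vec |M| (funArity f)) → to (fM f as) ≡ fN f (map to as)
      presRel : ∀ R (as : Vec |M| (relArity R)) → rM R as ⇔ rN R (map to as)

  IsScottSentence : ∀ {n} → Structure → DSigmaSentence n → Set₁
  IsScottSentence A φ =
    _⊨d_ A φ × ((M : Structure) → Countable M → _⊨d_ M φ → M ≅ A)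

  IsQuasiScottSentence : ∀ {n} → Structure → DSigmaSentence n → Set₁
  IsQuasiScottSentence A φ =
    _⊨d_ A φ × ((M : Structure) → FinitelyGenerated M → _⊨d_ M φ → M ≅ A)

-- Signature: unary f and k j (j ∈ ℕ).  The
-- tower over a successor set (B , s) has nodes (L , b), a tree of
-- k-branches L above the point b of the s-chain; k j grows a branch, f
-- removes one or moves along the chain.  A is the tower over ℕ, generated
-- by its root; M the tower over ℤ, countable and not finitely generated.
--
-- No Scott sentence: every d-Σ₂ sentence true in S holds in T if some
-- embedding ι : S → T has retractions injective on any finite set (Σ₂ goes
-- up) and all finite tuples of T are covered by embeddings S → T (Π₂ goes
-- up).  For A, M: collapse the negative chain into a fresh branch; shift.
--
-- Quasi Scott sentence ψ: a k-free element exists, plus Σ₁ axioms making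
-- k-branches behave as in A over f-chains meeting each other.  In a finitely
-- generated model all generators hang over one k-free root z, and placing
-- A over z is a bijective homomorphism, so the model is isomorphic to A.
module Submission where

open import Defs
open import Level using (0ℓ)
open import Axiom.ExcludedMiddle using (ExcludedMiddle)
open import Data.Bool using (true)
open import Data.Empty using (⊥; ⊥-elim)
open import Data.Fin using (zero; suc)
open import Data.Integer as ℤ using (ℤ; +_; -[1+_])
import Data.Integer.Properties as ℤ
open import Algebra.Properties.AbelianGroup ℤ.+-0-abelianGroup using () renaming (∙-cancelʳ to +-cancelʳ)
open import Data.List as List using (List; []; _∷_; replicate; length) renaming (_++_ to _++ₗ_)
import Data.List.Properties as List
open import Data.List.Extrema.Nat using (max; xs≤max)
open import Data.List.Membership.Propositional using (_∈_)
open import Data.List.Membership.Propositional.Properties using (∈-++⁺ˡ; ∈-++⁺ʳ)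
open import Data.List.Relation.Unary.All as All using (All; []; _∷_)
import Data.List.Relation.Unary.All.Properties as All
open import Data.List.Relation.Unary.Any using (here; there)
open import Data.Nat as ℕ using (ℕ; zero; suc; _+_; _≤_; _<_; z≤n; s≤s)
import Data.Nat.Properties as ℕ
open import Data.Product using (Σ; Σ-syntax; _×_; _,_; proj₁; proj₂)
open import Data.Sum using (_⊎_; inj₁; inj₂)
open import Data.Unit using (tt)
open import Data.Vec using (Vec; []; _∷_; lookup; map; _++_)
import Data.Vec.Properties as Vec
open import Function.Bundles using (_⇔_; mk⇔; mk↣; mk⤖; Equivalence; Bijection)
open import Function.Definitions using (Injective)
open import Function.Properties.Equivalence using () renaming (sym to ⇔-sym)
open import Relation.Binary.Definitions using (tri<; tri≈; tri>)
open import Relation.Nullary using (¬_; yes; no)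
open import Relation.Binary.PropositionalEquality

InjectiveOn : {A B : Set} → (A → B) → List A → Set
InjectiveOn h xs = ∀ {x y} → x ∈ xs → y ∈ xs → h x ≡ h y → x ≡ y

injectiveOn-++ˡ : {A B : Set} {h : A → B} (xs : List A) {ys : List A} →
                  InjectiveOn h (xs ++ₗ ys) → InjectiveOn h xs
injectiveOn-++ˡ xs inj x∈ y∈ = inj (∈-++⁺ˡ x∈) (∈-++⁺ˡ y∈)

injectiveOn-++ʳ : {A B : Set} {h : A → B} (xs : List A) {ys : List A} →
                  InjectiveOn h (xs ++ₗ ys) → InjectiveOn h ys
injectiveOn-++ʳ xs inj x∈ y∈ = inj (∈-++⁺ʳ xs x∈) (∈-++⁺ʳ xs y∈)

map-inverse : {A B : Set} {f : B → A} {g : A → B} → (∀ x → f (g x) ≡ x) →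
              ∀ {n} (v : Vec A n) → map f (map g v) ≡ v
map-inverse {f = f} {g} f∘g v =
  trans (sym (Vec.map-∘ f g v)) (trans (Vec.map-cong f∘g v) (Vec.map-id v))

module _ {L : Signature} where
  open Signature L
  open Structure

  record Hom (S T : Structure L) : Set where
    field
      fun      : Carrier S → Carrier T
      pres-fun : ∀ f (as : Vec (Carrier S) (funArity f)) →
                 fun (funI S f as) ≡ funI T f (map fun as)
      pres-rel : ∀ R (as : Vec (Carrier S) (relArity R)) →
                 relI S R as ⇔ relI T R (map fun as)
  open Hom public

  ≅⇒Hom : {S T : Structure L} → _≅_ L S T → Hom S T
  ≅⇒Hom iso = record { fun = to ; pres-fun = presFun ; pres-rel = presRel }
    where open _≅_ iso

  equatedValues : (S : Structure L) → ∀ {k} → QF L k → Vec (Carrier S) k → List (Carrier S)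
  equatedValues S (eq t s)   e = eval L S t e ∷ eval L S s e ∷ []
  equatedValues S (neg θ)    e = equatedValues S θ e
  equatedValues S (conj θ χ) e = equatedValues S θ e ++ₗ equatedValues S χ e
  equatedValues S (disj θ χ) e = equatedValues S θ e ++ₗ equatedValues S χ e
  equatedValues S qtrue      e = []
  equatedValues S qfalse     e = []
  equatedValues S (rel R ts) e = []

  module _ {S T : Structure L} (h : Hom S T) where

    eval-hom : ∀ {k} (t : Term L k) (e : Vec (Carrier S) k) →
               eval L T t (map (fun h) e) ≡ fun h (eval L S t e)
    evals-hom : ∀ {k n} (ts : Vec (Term L k) n) (e : Vec (Carrier S) k) →
                evals L T ts (map (fun h) e) ≡ map (fun h) (evals L S ts e)
    eval-hom (var x) e = Vec.lookup-map x (fun h) e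
    eval-hom (app f ts) e = begin
      funI T f (evals L T ts (map (fun h) e)) ≡⟨ cong (funI T f) (evals-hom ts e) ⟩
      funI T f (map (fun h) (evals L S ts e)) ≡⟨ pres-fun h f _ ⟨
      fun h (funI S f (evals L S ts e))       ∎
      where open ≡-Reasoning
    evals-hom []       e = refl
    evals-hom (t ∷ ts) e = cong₂ _∷_ (eval-hom t e) (evals-hom ts e)

    qf-preserved : ∀ {k} (θ : QF L k) (e : Vec (Carrier S) k) →
                   InjectiveOn (fun h) (equatedValues S θ e) →
                   satQF L S θ e ⇔ satQF L T θ (map (fun h) e)
    qf-preserved qtrue e _ = mk⇔ (λ _ → tt) (λ _ → tt)
    qf-preserved qfalse e _ = mk⇔ (λ ()) (λ ())
    qf-preserved (eq t s) e inj = mk⇔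
      (λ t≡s → trans (eval-hom t e) (trans (cong (fun h) t≡s) (sym (eval-hom s e))))
      (λ t≡s → inj (here refl) (there (here refl))
                   (trans (sym (eval-hom t e)) (trans t≡s (eval-hom s e))))
    qf-preserved (rel R ts) e _ =
      subst (λ v → relI S R (evals L S ts e) ⇔ relI T R v) (sym (evals-hom ts e)) (pres-rel h R _)
    qf-preserved (neg θ) e inj = mk⇔ (λ ¬s s → ¬s (from s)) (λ ¬s s → ¬s (to s))
      where open Equivalence (qf-preserved θ e inj)
    qf-preserved (conj θ χ) e inj = mk⇔ (λ (s , s′) → to θ′ s , to χ′ s′)
                                        (λ (s , s′) → from θ′ s , from χ′ s′)
      where
      θ′ : satQF L S θ e ⇔ satQF L T θ (map (fun h) e)
      θ′ = qf-preserved θ e (injectiveOn-++ˡ _ inj)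
      χ′ : satQF L S χ e ⇔ satQF L T χ (map (fun h) e)
      χ′ = qf-preserved χ e (injectiveOn-++ʳ _ inj)
      open Equivalence
    qf-preserved (disj θ χ) e inj =
      mk⇔ (λ { (inj₁ s) → inj₁ (to θ′ s) ; (inj₂ s) → inj₂ (to χ′ s) })
          (λ { (inj₁ s) → inj₁ (from θ′ s) ; (inj₂ s) → inj₂ (from χ′ s) })
      where
      θ′ : satQF L S θ e ⇔ satQF L T θ (map (fun h) e)
      θ′ = qf-preserved θ e (injectiveOn-++ˡ _ inj)
      χ′ : satQF L S χ e ⇔ satQF L T χ (map (fun h) e)
      χ′ = qf-preserved χ e (injectiveOn-++ʳ _ inj)
      open Equivalence

  module _ {S T : Structure L} (h : Hom S T) (inj : Injective _≡_ _≡_ (fun h)) where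

    Π₀-up : ∀ {b k} (ψ : Πf L b k) → b ≤ 0 → (e : Vec (Carrier S) k) →
            satΠ L S ψ e → satΠ L T ψ (map (fun h) e)
    Π₀-up (qfΠ θ) _ e = Equivalence.to (qf-preserved h θ e (λ _ _ → inj))

    Σ₁-up : ∀ {n k} (φ : Σf L n k) → n ≤ 1 → (e : Vec (Carrier S) k) →
            satΣ L S φ e → satΣ L T φ (map (fun h) e)
    Σ₁-up (qfΣ θ) _ e = Equivalence.to (qf-preserved h θ e (λ _ _ → inj))
    Σ₁-up (⋁∃ I β β≤ m φ) (s≤s z≤n) e (i , Ii , a , s) =
      i , Ii , map (fun h) a ,
      subst (satΠ L T (φ i)) (Vec.map-++ (fun h) a e) (Π₀-up (φ i) (β≤ i) (a ++ e) s)

  SeparatingRetractions : {S T : Structure L} → Hom S T → Set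
  SeparatingRetractions {S} {T} ι = (xs : List (Carrier T)) →
    Σ[ r ∈ Hom T S ] ((∀ x → fun r (fun ι x) ≡ x) × InjectiveOn (fun r) xs)

  module _ {S T : Structure L} (ι : Hom S T) (retract : SeparatingRetractions ι) where

    pull-back : (r : Hom T S) → (∀ x → fun r (fun ι x) ≡ x) →
                ∀ {m k} (c : Vec (Carrier T) m) (e : Vec (Carrier S) k) →
                map (fun r) (c ++ map (fun ι) e) ≡ map (fun r) c ++ e
    pull-back r r∘ι c e = begin
      map (fun r) (c ++ map (fun ι) e)              ≡⟨ Vec.map-++ (fun r) c _ ⟩
      map (fun r) c ++ map (fun r) (map (fun ι) e)  ≡⟨ cong (map (fun r) c ++_) (map-inverse r∘ι e) ⟩
      map (fun r) c ++ e                            ∎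
      where open ≡-Reasoning

    -- A quantifier-free property of all tuples a ++ e in S holds for all
    -- tuples c ++ ι(e) in T: pull c back along a retraction separating
    -- the terms of θ.
    qf-up : ∀ {m k} (θ : QF L (m + k)) (e : Vec (Carrier S) k) →
            ((a : Vec (Carrier S) m) → satQF L S θ (a ++ e)) →
            (c : Vec (Carrier T) m) → satQF L T θ (c ++ map (fun ι) e)
    qf-up θ e holds c with retract (equatedValues T θ (c ++ map (fun ι) e))
    ... | r , r∘ι , r-separates =
      Equivalence.from (qf-preserved r θ (c ++ map (fun ι) e) r-separates)
        (subst (satQF L S θ) (sym (pull-back r r∘ι c e)) (holds (map (fun r) c)))

    Σ₀-up : ∀ {b m k} (ψ : Σf L b (m + k)) → b ≤ 0 → (e : Vec (Carrier S) k) →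
            ((a : Vec (Carrier S) m) → satΣ L S ψ (a ++ e)) →
            (c : Vec (Carrier T) m) → satΣ L T ψ (c ++ map (fun ι) e)
    Σ₀-up (qfΣ θ) _ = qf-up θ

    Π₁-up : ∀ {n k} (φ : Πf L n k) → n ≤ 1 → (e : Vec (Carrier S) k) →
            satΠ L S φ e → satΠ L T φ (map (fun ι) e)
    Π₁-up (qfΠ θ) _ e s = qf-up {m = 0} θ e (λ { [] → s }) []
    Π₁-up (⋀∀ I β β≤ m φ) (s≤s z≤n) e s i Ii = Σ₀-up (φ i) (β≤ i) e (s i Ii)

    Σ₂-up : ∀ {k} (φ : Σf L 2 k) (e : Vec (Carrier S) k) →
            satΣ L S φ e → satΣ L T φ (map (fun ι) e)
    Σ₂-up (⋁∃ I β β≤ m φ) e (i , Ii , a , s) =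
      i , Ii , map (fun ι) a ,
      subst (satΠ L T (φ i)) (Vec.map-++ (fun ι) a e) (Π₁-up (φ i) (β≤ i) (a ++ e) s)

  CoveredByEmbeddings : Structure L → Structure L → Set
  CoveredByEmbeddings S T = ∀ {m} (c : Vec (Carrier T) m) →
    Σ[ h ∈ Hom S T ] (Injective _≡_ _≡_ (fun h) × Σ[ a ∈ Vec (Carrier S) m ] map (fun h) a ≡ c)

  Π₂-up : {S T : Structure L} → CoveredByEmbeddings S T →
          (φ : Πf L 2 0) → satΠ L S φ [] → satΠ L T φ []
  Π₂-up cover (⋀∀ I β β≤ m φ) s i Ii c with cover c
  ... | h , inj , a , refl =
    subst (satΣ L _ (φ i)) (Vec.map-++ (fun h) a []) (Σ₁-up h inj (φ i) (β≤ i) (a ++ []) (s i Ii a))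

  -- Under both conditions every d-Σ₂ sentence true in S is true in T; if
  -- T is countable and not isomorphic to S, S has no d-Σ₂ Scott sentence.
  no-dΣ₂-Scott-sentence : {S T : Structure L} (ι : Hom S T) →
    SeparatingRetractions ι → CoveredByEmbeddings S T →
    Countable L T → ¬ (_≅_ L T S) →
    ¬ (Σ[ φ ∈ DSigmaSentence L 2 ] IsScottSentence L S φ)
  no-dΣ₂-Scott-sentence {T = T} ι retract cover countable T≇S ((σ ∧d π) , (S⊨σ , S⊨π) , unique) =
    T≇S (unique T countable (Σ₂-up ι retract σ [] S⊨σ , Π₂-up cover π S⊨π))

  fg-≅ : {M N : Structure L} → _≅_ L M N → FinitelyGenerated L N → FinitelyGenerated L M
  fg-≅ {M} {N} iso (k , g , generates) = k , map to⁻ g , λ x →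
    let (t , t≡) = generates (to x) in
    t , injective (begin
      to (eval L M t (map to⁻ g))          ≡⟨ eval-hom (≅⇒Hom iso) t (map to⁻ g) ⟨
      eval L N t (map to (map to⁻ g))      ≡⟨ cong (eval L N t) (map-inverse to∘to⁻ g) ⟩
      eval L N t g                         ≡⟨ t≡ ⟩
      to x                                 ∎)
    where
    open _≅_ iso using (bij)
    open Bijection bij using (to; to⁻; injective; strictlySurjective)
    open ≡-Reasoning
    to∘to⁻ : ∀ y → to (to⁻ y) ≡ y
    to∘to⁻ y = proj₂ (strictlySurjective y)

  onto-generators : {S T : Structure L} (h : Hom S T) → ∀ {k} (g : Vec (Carrier T) k) →
    ((y : Carrier T) → Σ[ t ∈ Term L k ] eval L T t g ≡ y) →
    Σ[ a ∈ Vec (Carrier S) k ] map (fun h) a ≡ g →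
    (y : Carrier T) → Σ[ x ∈ Carrier S ] fun h x ≡ y
  onto-generators h g generates (a , refl) y =
    let (t , t≡y) = generates y in eval L _ t a , trans (sym (eval-hom h t a)) t≡y

  bijective-hom⇒≅ : {S T : Structure L} (h : Hom S T) → Injective _≡_ _≡_ (fun h) →
    ((y : Carrier T) → Σ[ x ∈ Carrier S ] fun h x ≡ y) → _≅_ L T S
  bijective-hom⇒≅ {S} {T} h inj onto = record
    { bij = mk⤖ {to = h⁻¹} (h⁻¹-injective , λ x → fun h x , λ { refl → h⁻¹∘h x })
    ; presFun = λ f as → inj (begin
        fun h (h⁻¹ (funI T f as))        ≡⟨ h∘h⁻¹ _ ⟩
        funI T f as                      ≡⟨ cong (funI T f) h∘h⁻¹-map ⟨
        funI T f (map (fun h) (map h⁻¹ as)) ≡⟨ pres-fun h f _ ⟨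
        fun h (funI S f (map h⁻¹ as))    ∎)
    ; presRel = λ R as → subst (λ v → relI T R v ⇔ relI S R (map h⁻¹ as)) h∘h⁻¹-map
                           (⇔-sym (pres-rel h R (map h⁻¹ as)))
    }
    where
    open ≡-Reasoning
    h⁻¹ : Carrier T → Carrier S
    h⁻¹ y = proj₁ (onto y)
    h∘h⁻¹ : ∀ y → fun h (h⁻¹ y) ≡ y
    h∘h⁻¹ y = proj₂ (onto y)
    h⁻¹∘h : ∀ x → h⁻¹ (fun h x) ≡ x
    h⁻¹∘h x = inj (h∘h⁻¹ (fun h x))
    h⁻¹-injective : Injective _≡_ _≡_ h⁻¹
    h⁻¹-injective {y} {y′} same = trans (sym (h∘h⁻¹ y)) (trans (cong (fun h) same) (h∘h⁻¹ y′))
    h∘h⁻¹-map : ∀ {n} {as : Vec (Carrier T) n} → map (fun h) (map h⁻¹ as) ≡ as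
    h∘h⁻¹-map {as = as} = map-inverse h∘h⁻¹ as

-- Cantor's enumeration of ℕ × ℕ along the diagonals, with a section.

next : ℕ × ℕ → ℕ × ℕ
next (zero  , j) = suc j , 0
next (suc i , j) = i , suc j

unpair : ℕ → ℕ × ℕ
unpair zero    = 0 , 0
unpair (suc n) = next (unpair n)

unpair-walk : ∀ d n i j → unpair n ≡ (d + i , j) → unpair (d + n) ≡ (i , d + j)
unpair-walk zero    n i j p = p
unpair-walk (suc d) n i j p =
  subst₂ (λ u v → unpair u ≡ (i , v)) (ℕ.+-suc d n) (ℕ.+-suc d j)
         (unpair-walk d (suc n) i (suc j) (cong next p))

unpair-diagonal : ∀ a → Σ[ n ∈ ℕ ] unpair n ≡ (a , 0)
unpair-diagonal zero = 0 , refl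
unpair-diagonal (suc a) =
  let (n , p) = unpair-diagonal a
      walked = unpair-walk a n 0 0 (subst (λ u → unpair n ≡ (u , 0)) (sym (ℕ.+-identityʳ a)) p)
  in suc (a + n) , subst (λ u → next (unpair (a + n)) ≡ (suc u , 0)) (ℕ.+-identityʳ a) (cong next walked)

unpair-surjective : ∀ i j → Σ[ n ∈ ℕ ] unpair n ≡ (i , j)
unpair-surjective i j =
  let (n , p) = unpair-diagonal (j + i) in
  j + n , subst (λ u → unpair (j + n) ≡ (i , u)) (ℕ.+-identityʳ j) (unpair-walk j n i 0 p)

pair : ℕ → ℕ → ℕ
pair i j = proj₁ (unpair-surjective i j)

unpair-pair : ∀ i j → unpair (pair i j) ≡ (i , j)
unpair-pair i j = proj₂ (unpair-surjective i j)

pair-injective : ∀ {i j i′ j′} → pair i j ≡ pair i′ j′ → i ≡ i′ × j ≡ j′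
pair-injective {i} {j} {i′} {j′} p =
  let q = trans (sym (unpair-pair i j)) (trans (cong unpair p) (unpair-pair i′ j′))
  in cong proj₁ q , cong proj₂ q

data Symbol : Set where
  symF : Symbol
  symK : ℕ → Symbol

symbolCode : Symbol → ℕ
symbolCode symF     = 0
symbolCode (symK j) = suc j

symbolCode-injective : Injective _≡_ _≡_ symbolCode
symbolCode-injective {symF}   {symF}    _    = refl
symbolCode-injective {symK i} {symK .i} refl = refl

Sig : Signature
Sig = record
  { FunSym = Symbol ; funArity = λ _ → 1 ; funCountable = mk↣ symbolCode-injective
  ; RelSym = ⊥ ; relArity = λ () ; relCountable = mk↣ {to = λ ()} (λ {x} → ⊥-elim x) }

f′ : ∀ {k} → Term Sig k → Term Sig k
f′ t = app symF (t ∷ [])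

k′ : ∀ {k} → ℕ → Term Sig k → Term Sig k
k′ j t = app (symK j) (t ∷ [])

f′^ : ∀ {k} → ℕ → Term Sig k → Term Sig k
f′^ zero    t = t
f′^ (suc n) t = f′ (f′^ n t)

k′* : ∀ {k} → List ℕ → Term Sig k → Term Sig k
k′* []      t = t
k′* (j ∷ L) t = k′ j (k′* L t)

unaryStructure : (C : Set) → (C → C) → (ℕ → C → C) → Structure Sig
unaryStructure C F K = record { Carrier = C ; funI = op ; relI = λ () }
  where
  op : (s : Symbol) → Vec C 1 → C
  op symF     (x ∷ []) = F x
  op (symK j) (x ∷ []) = K j x

module _ (S : Structure Sig) where
  open Structure S

  F : Carrier → Carrier
  F x = funI symF (x ∷ [])

  K : ℕ → Carrier → Carrier
  K j x = funI (symK j) (x ∷ [])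

  F^ : ℕ → Carrier → Carrier
  F^ zero    x = x
  F^ (suc n) x = F (F^ n x)

  K* : List ℕ → Carrier → Carrier
  K* []      x = x
  K* (j ∷ L) x = K j (K* L x)

  eval-f′^ : ∀ {k} n (t : Term Sig k) e → eval Sig S (f′^ n t) e ≡ F^ n (eval Sig S t e)
  eval-f′^ zero    t e = refl
  eval-f′^ (suc n) t e = cong F (eval-f′^ n t e)

  eval-k′* : ∀ {k} L (t : Term Sig k) e → eval Sig S (k′* L t) e ≡ K* L (eval Sig S t e)
  eval-k′* []      t e = refl
  eval-k′* (j ∷ L) t e = cong (K j) (eval-k′* L t e)

  F^-+ : ∀ m n x → F^ m (F^ n x) ≡ F^ (m + n) x
  F^-+ zero    n x = refl
  F^-+ (suc m) n x = cong F (F^-+ m n x)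

  F^-suc : ∀ n x → F^ n (F x) ≡ F^ (suc n) x
  F^-suc n x = trans (F^-+ n 1 x) (cong (λ m → F^ m x) (ℕ.+-comm n 1))

mkHom : {S T : Structure Sig} (h : Structure.Carrier S → Structure.Carrier T) →
        (∀ x → h (F S x) ≡ F T (h x)) → (∀ j x → h (K S j x) ≡ K T j (h x)) → Hom S T
mkHom {S} {T} h hF hK = record { fun = h ; pres-fun = pres ; pres-rel = λ () }
  where
  open Structure
  pres : ∀ s (as : Vec (Carrier S) 1) → h (funI S s as) ≡ funI T s (map h as)
  pres symF     (x ∷ []) = hF x
  pres (symK j) (x ∷ []) = hK j x

-- The tower over a set B with a successor s: a node (L , b) sits above the
-- point b of the s-chain, reached by the branches listed in L.  k j grows
-- a branch, f removes the last one grown, and on the chain f is s.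

Node : Set → Set
Node B = List ℕ × B

up : {B : Set} → (B → B) → Node B → Node B
up s (j ∷ L , b) = L , b
up s ([]    , b) = [] , s b

Tower : (B : Set) → (B → B) → Structure Sig
Tower B s = unaryStructure (Node B) (up s) (λ j (L , b) → j ∷ L , b)

tower-hom : {B B′ : Set} {s : B → B} {s′ : B′ → B′} (g : B → B′) →
            (∀ b → g (s b) ≡ s′ (g b)) → Hom (Tower B s) (Tower B′ s′)
tower-hom {s = s} {s′} g g-suc = mkHom (λ (L , b) → L , g b) commute (λ j x → refl)
  where
  commute : ∀ x → (proj₁ (up s x) , g (proj₂ (up s x))) ≡ up s′ (proj₁ x , g (proj₂ x))
  commute (j ∷ L , b) = refl
  commute ([]    , b) = cong ([] ,_) (g-suc b)

tower-hom-injective : {B B′ : Set} {s : B → B} {s′ : B′ → B′} (g : B → B′) →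
  (g-suc : ∀ b → g (s b) ≡ s′ (g b)) → Injective _≡_ _≡_ g →
  Injective _≡_ _≡_ (fun (tower-hom {s = s} {s′} g g-suc))
tower-hom-injective g g-suc g-inj {L , b} {L′ , b′} p =
  cong₂ _,_ (cong proj₁ p) (g-inj (cong proj₂ p))

A : Structure Sig
A = Tower ℕ suc

M : Structure Sig
M = Tower ℤ ℤ.suc

-- A is generated by its root ([] , 0): (L , b) = k_L (fᵇ root).

root : Node ℕ
root = [] , 0

F^-root : ∀ b → F^ A b root ≡ ([] , b)
F^-root zero    = refl
F^-root (suc b) = cong (up suc) (F^-root b)

K*-node : ∀ L b → K* A L ([] , b) ≡ (L , b)
K*-node []      b = refl
K*-node (j ∷ L) b = cong (λ (L′ , b′) → j ∷ L′ , b′) (K*-node L b)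

A-fg : FinitelyGenerated Sig A
A-fg = 1 , root ∷ [] , λ (L , b) → k′* L (f′^ b (var zero)) ,
  (begin
    eval Sig A (k′* L (f′^ b (var zero))) (root ∷ []) ≡⟨ eval-k′* A L _ _ ⟩
    K* A L (eval Sig A (f′^ b (var zero)) (root ∷ [])) ≡⟨ cong (K* A L) (eval-f′^ A b _ _) ⟩
    K* A L (F^ A b root)                               ≡⟨ cong (K* A L) (F^-root b) ⟩
    K* A L ([] , b)                                    ≡⟨ K*-node L b ⟩
    (L , b)                                            ∎)
  where open ≡-Reasoning

-- M is not finitely generated: no term lowers the ℤ-level, so a node
-- below the lowest generator is never reached.

minLevel : ∀ {k} → Vec (Node ℤ) k → ℤ
minLevel []            = ℤ.0ℤ
minLevel ((_ , z) ∷ g) = z ℤ.⊓ minLevel g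

minLevel-≤ : ∀ {k} (g : Vec (Node ℤ) k) i → minLevel g ℤ.≤ proj₂ (lookup g i)
minLevel-≤ ((_ , z) ∷ g) zero    = ℤ.i⊓j≤i z (minLevel g)
minLevel-≤ ((_ , z) ∷ g) (suc i) = ℤ.≤-trans (ℤ.i⊓j≤j z (minLevel g)) (minLevel-≤ g i)

up-raises-level : ∀ x → proj₂ x ℤ.≤ proj₂ (up ℤ.suc x)
up-raises-level (j ∷ L , z) = ℤ.≤-refl
up-raises-level ([]    , z) = ℤ.i≤suc[i] z

terms-above-minLevel : ∀ {k} (g : Vec (Node ℤ) k) (t : Term Sig k) →
                       minLevel g ℤ.≤ proj₂ (eval Sig M t g)
terms-above-minLevel g (var i)                = minLevel-≤ g i
terms-above-minLevel g (app symF (t ∷ []))     =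
  ℤ.≤-trans (terms-above-minLevel g t) (up-raises-level (eval Sig M t g))
terms-above-minLevel g (app (symK j) (t ∷ [])) = terms-above-minLevel g t

M-not-fg : ¬ FinitelyGenerated Sig M
M-not-fg (k , g , generates) =
  ℤ.<-irrefl refl (ℤ.suc[i]≤j⇒i<j (subst (ℤ._≤ ℤ.pred m) (sym (ℤ.suc-pred m)) m≤pred-m))
  where
  m : ℤ
  m = minLevel g
  t : Term Sig k
  t = proj₁ (generates ([] , ℤ.pred m))
  m≤pred-m : m ℤ.≤ ℤ.pred m
  m≤pred-m = subst (λ x → m ℤ.≤ proj₂ x) (proj₂ (generates ([] , ℤ.pred m))) (terms-above-minLevel g t)

M≇A : ¬ (_≅_ Sig M A)
M≇A M≅A = M-not-fg (fg-≅ M≅A A-fg)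

listCode : List ℕ → ℕ
listCode []       = 0
listCode (x ∷ xs) = suc (pair x (listCode xs))

listCode-injective : Injective _≡_ _≡_ listCode
listCode-injective {[]}     {[]}     _ = refl
listCode-injective {x ∷ xs} {y ∷ ys} p =
  let (x≡y , rest) = pair-injective (ℕ.suc-injective p)
  in cong₂ _∷_ x≡y (listCode-injective rest)

intCode : ℤ → ℕ
intCode (+ n)    = pair 0 n
intCode -[1+ n ] = pair 1 n

intCode-injective : Injective _≡_ _≡_ intCode
intCode-injective {+ m}     {+ n}     p = cong +_ (proj₂ (pair-injective p))
intCode-injective {+ m}     { -[1+ n ]} p with () ← proj₁ (pair-injective {0} {m} {1} {n} p)
intCode-injective { -[1+ m ]} {+ n}     p with () ← proj₁ (pair-injective {1} {m} {0} {n} p)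
intCode-injective { -[1+ m ]} { -[1+ n ]} p = cong -[1+_] (proj₂ (pair-injective p))

M-countable : Countable Sig M
M-countable = (λ (L , z) → pair (listCode L) (intCode z)) ,
  λ {(L , z)} {(L′ , z′)} p → let (L≡ , z≡) = pair-injective p in
    cong₂ _,_ (listCode-injective L≡) (intCode-injective z≡)

ι : Hom A M
ι = tower-hom +_ (λ _ → refl)

-- Separating retractions of ι.  collapse N folds the negative part of the
-- ℤ-chain into a branch labelled N above the root: the node at level
-- -(m+1) goes to the node reached by m+1 steps along that branch.  It is
-- injective on nodes whose labels are all below N.

collapse : ℕ → Node ℤ → Node ℕ
collapse N (L , + b)      = L , b
collapse N (L , -[1+ m ]) = L ++ₗ replicate (suc m) N , 0

collapse-hom : ℕ → Hom M A
collapse-hom N = mkHom (collapse N) commute (λ { j (L , + b) → refl ; j (L , -[1+ m ]) → refl })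
  where
  commute : ∀ x → collapse N (up ℤ.suc x) ≡ up suc (collapse N x)
  commute (j ∷ L , + b)          = refl
  commute (j ∷ L , -[1+ m ])     = refl
  commute ([]    , + b)          = refl
  commute ([]    , -[1+ zero ])  = refl
  commute ([]    , -[1+ suc m ]) = refl

Fresh : ℕ → Node ℤ → Set
Fresh N x = All (_< N) (proj₁ x)

fresh-∌ : ∀ {N} L {r} → ¬ All (_< N) (L ++ₗ N ∷ r)
fresh-∌ []      (N<N ∷ _) = ℕ.<-irrefl refl N<N
fresh-∌ (j ∷ L) (_ ∷ f)   = fresh-∌ L f

padding-injective : ∀ {N} L L′ m m′ → All (_< N) L → All (_< N) L′ →
  L ++ₗ replicate m N ≡ L′ ++ₗ replicate m′ N → L ≡ L′ × m ≡ m′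
padding-injective [] [] m m′ _ _ p =
  refl , trans (sym (List.length-replicate m)) (trans (cong length p) (List.length-replicate m′))
padding-injective [] (j ∷ L′) (suc m) m′ _ (j<N ∷ _) p =
  ⊥-elim (ℕ.<-irrefl (sym (proj₁ (List.∷-injective p))) j<N)
padding-injective (j ∷ L) [] m (suc m′) (j<N ∷ _) _ p =
  ⊥-elim (ℕ.<-irrefl (proj₁ (List.∷-injective p)) j<N)
padding-injective (j ∷ L) (j′ ∷ L′) m m′ (_ ∷ f) (_ ∷ f′) p =
  let (j≡j′ , tails) = List.∷-injective p
      (L≡L′ , m≡m′) = padding-injective L L′ m m′ f f′ tails
  in cong₂ _∷_ j≡j′ L≡L′ , m≡m′
padding-injective [] (j ∷ L′) zero m′ _ _ ()
padding-injective (j ∷ L) [] m zero _ _ ()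

collapse-injective : ∀ N {x y} → Fresh N x → Fresh N y → collapse N x ≡ collapse N y → x ≡ y
collapse-injective N {L , + b} {L′ , + b′} _ _ refl = refl
collapse-injective N {L , + b} {L′ , -[1+ m′ ]} fx _ p =
  ⊥-elim (fresh-∌ L′ (subst (All (_< N)) (cong proj₁ p) fx))
collapse-injective N {L , -[1+ m ]} {L′ , + b′} _ fy p =
  ⊥-elim (fresh-∌ L (subst (All (_< N)) (cong proj₁ (sym p)) fy))
collapse-injective N {L , -[1+ m ]} {L′ , -[1+ m′ ]} fx fy p =
  let (L≡L′ , m≡m′) = padding-injective L L′ (suc m) (suc m′) fx fy (cong proj₁ p)
  in cong₂ _,_ L≡L′ (cong -[1+_] (ℕ.suc-injective m≡m′))

fresh-bound : (xs : List (Node ℤ)) → Σ[ N ∈ ℕ ] All (Fresh N) xs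
fresh-bound xs = suc (max 0 labels) ,
  All.map (All.map s≤s) (All.map⁻ (All.concat⁻ (xs≤max 0 labels)))
  where
  labels : List ℕ
  labels = List.concat (List.map proj₁ xs)

ι-retractions : SeparatingRetractions ι
ι-retractions xs with fresh-bound xs
... | N , fresh = collapse-hom N , (λ _ → refl) ,
  λ x∈ y∈ → collapse-injective N (All.lookup fresh x∈) (All.lookup fresh y∈)

-- Covering M by embeddings of A: shift n moves the ℕ-chain down by n, so
-- every finite set of nodes lies in the image of some shift.

shiftℤ : ℕ → ℕ → ℤ
shiftℤ n b = + b ℤ.- + n

shiftℤ-suc : ∀ n b → shiftℤ n (suc b) ≡ ℤ.suc (shiftℤ n b)
shiftℤ-suc n b = ℤ.+-assoc (+ 1) (+ b) (ℤ.- + n)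

shift : ℕ → Hom A M
shift n = tower-hom (shiftℤ n) (shiftℤ-suc n)

shift-injective : ∀ n → Injective _≡_ _≡_ (fun (shift n))
shift-injective n = tower-hom-injective {s = suc} {ℤ.suc} (shiftℤ n) (shiftℤ-suc n)
  (λ p → ℤ.+-injective (+-cancelʳ (ℤ.- + n) (+ _) (+ _) p))

depth : ℤ → ℕ
depth (+ _)      = 0
depth -[1+ m ]   = suc m

shiftℤ-onto : ∀ z n → depth z ℕ.≤ n → Σ[ b ∈ ℕ ] shiftℤ n b ≡ z
shiftℤ-onto (+ c) n _ = c + n , (begin
  (+ c ℤ.+ + n) ℤ.- + n   ≡⟨ ℤ.+-assoc (+ c) (+ n) (ℤ.- + n) ⟩
  + c ℤ.+ (+ n ℤ.- + n)   ≡⟨ cong (λ i → + c ℤ.+ i) (ℤ.+-inverseʳ (+ n)) ⟩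
  + c ℤ.+ ℤ.0ℤ            ≡⟨ ℤ.+-identityʳ (+ c) ⟩
  + c                     ∎)
  where open ≡-Reasoning
shiftℤ-onto -[1+ m ] n m<n = n ℕ.∸ suc m , (begin
  + (n ℕ.∸ suc m) ℤ.- + n       ≡⟨ ℤ.m-n≡m⊖n (n ℕ.∸ suc m) n ⟩
  (n ℕ.∸ suc m) ℤ.⊖ n            ≡⟨ ℤ.⊖-≤ (ℕ.m∸n≤m n (suc m)) ⟩
  ℤ.- + (n ℕ.∸ (n ℕ.∸ suc m))    ≡⟨ cong (λ d → ℤ.- + d) (ℕ.m∸[m∸n]≡n m<n) ⟩
  -[1+ m ]                       ∎)
  where open ≡-Reasoning

totalDepth : ∀ {k} → Vec (Node ℤ) k → ℕ
totalDepth []            = 0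
totalDepth ((_ , z) ∷ c) = depth z + totalDepth c

shift-onto : ∀ {k} n (c : Vec (Node ℤ) k) → totalDepth c ℕ.≤ n →
             Σ[ a ∈ Vec (Node ℕ) k ] map (fun (shift n)) a ≡ c
shift-onto n []            _ = [] , refl
shift-onto n ((L , z) ∷ c) d≤n =
  let (b , b↦z) = shiftℤ-onto z n (ℕ.≤-trans (ℕ.m≤m+n _ _) d≤n)
      (a , a↦c) = shift-onto n c (ℕ.≤-trans (ℕ.m≤n+m _ _) d≤n)
  in (L , b) ∷ a , cong₂ _∷_ (cong (L ,_) b↦z) a↦c

M-covered : CoveredByEmbeddings A M
M-covered c = shift (totalDepth c) , shift-injective (totalDepth c) , shift-onto (totalDepth c) c ℕ.≤-refl

A-no-dΣ₂-Scott-sentence : ¬ (Σ[ φ ∈ DSigmaSentence Sig 2 ] IsScottSentence Sig A φ)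
A-no-dΣ₂-Scott-sentence = no-dΣ₂-Scott-sentence ι ι-retractions M-covered M-countable M≇A

w x y : Term Sig 3
w = var zero
x = var (suc zero)
y = var (suc (suc zero))

∃w⋁ : (ℕ → QF Sig 3) → Σf Sig 1 2
∃w⋁ θ = ⋁∃ (λ _ → true) (λ _ → 0) (λ _ → z≤n) (λ _ → 1) (λ i → qfΠ (θ i))

module _ (S : Structure Sig) where
  open Structure S

  Witnessed : (ℕ → QF Sig 3) → Carrier → Carrier → Set
  Witnessed θ a b = Σ[ i ∈ ℕ ] Σ[ c ∈ Carrier ] satQF Sig S (θ i) (c ∷ a ∷ b ∷ [])

  ∃w⋁-intro : ∀ θ a b → Witnessed θ a b → satΣ Sig S (∃w⋁ θ) (a ∷ b ∷ [])
  ∃w⋁-intro θ a b (i , c , s) = i , refl , c ∷ [] , s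

  ∃w⋁-elim : ∀ θ a b → satΣ Sig S (∃w⋁ θ) (a ∷ b ∷ []) → Witnessed θ a b
  ∃w⋁-elim θ a b (i , _ , c ∷ [] , s) = i , c , s

data Axiom : Set where
  f-undoes-k       : ℕ → Axiom
  k-disjoint       : ℕ → ℕ → Axiom
  f-acyclic        : ℕ → Axiom
  f-keeps-kfree    : ℕ → Axiom
  f-injective-free : Axiom
  connected        : Axiom

meet : ℕ × ℕ → QF Sig 3
meet (p , q) = eq (f′^ p x) (f′^ q y)

k-image : ℕ → QF Sig 3
k-image i = disj (eq (k′ i w) x) (eq (k′ i w) y)

body : Axiom → ℕ → QF Sig 3
body (f-undoes-k j)   _       = eq (f′ (k′ j x)) x
body (k-disjoint i d) _       = neg (eq (k′ i x) (k′ (suc (i + d)) y))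
body (f-acyclic n)    _       = neg (eq (f′^ (suc n) x) x)
body (f-keeps-kfree j) zero   = neg (eq (k′ j y) (f′ x))
body (f-keeps-kfree j) (suc i) = eq (k′ i w) x
body f-injective-free zero    = disj (eq x y) (neg (eq (f′ x) (f′ y)))
body f-injective-free (suc i) = k-image i
body connected        n       = meet (unpair n)

decodeTagged : ℕ × ℕ → Axiom
decodeTagged (0 , j) = f-undoes-k j
decodeTagged (1 , c) = k-disjoint (proj₁ (unpair c)) (proj₂ (unpair c))
decodeTagged (2 , n) = f-acyclic n
decodeTagged (3 , j) = f-keeps-kfree j
decodeTagged (4 , _) = f-injective-free
decodeTagged (suc (suc (suc (suc (suc _)))) , _) = connected

decode : ℕ → Axiom
decode n = decodeTagged (unpair n)

code : Axiom → ℕ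
code (f-undoes-k j)    = pair 0 j
code (k-disjoint i d)  = pair 1 (pair i d)
code (f-acyclic n)     = pair 2 n
code (f-keeps-kfree j) = pair 3 j
code f-injective-free  = pair 4 0
code connected         = pair 5 0

decode-code : ∀ a → decode (code a) ≡ a
decode-code (f-undoes-k j)    = cong decodeTagged (unpair-pair 0 j)
decode-code (k-disjoint i d)  =
  trans (cong decodeTagged (unpair-pair 1 (pair i d)))
        (cong (λ (i′ , d′) → k-disjoint i′ d′) (unpair-pair i d))
decode-code (f-acyclic n)     = cong decodeTagged (unpair-pair 2 n)
decode-code (f-keeps-kfree j) = cong decodeTagged (unpair-pair 3 j)
decode-code f-injective-free  = cong decodeTagged (unpair-pair 4 0)
decode-code connected         = cong decodeTagged (unpair-pair 5 0)

is-kfree : Πf Sig 1 1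
is-kfree = ⋀∀ (λ _ → true) (λ _ → 0) (λ _ → z≤n) (λ _ → 1)
              (λ j → qfΣ (neg (eq (k′ j (var zero)) (var (suc zero)))))

some-kfree : Σf Sig 2 0
some-kfree = ⋁∃ (λ _ → true) (λ _ → 1) (λ _ → s≤s z≤n) (λ _ → 1) (λ _ → is-kfree)

all-axioms : Πf Sig 2 0
all-axioms = ⋀∀ (λ _ → true) (λ _ → 1) (λ _ → s≤s z≤n) (λ _ → 2)
                 (λ n → ∃w⋁ (body (decode n)))

ψ : DSigmaSentence Sig 2
ψ = some-kfree ∧d all-axioms

-- A satisfies ψ.  The only axiom needing an argument is acyclicity:
-- f raises b − |L| by one: after n steps from (L , b) to (L′ , b′),
-- b′ + |L| = n + b + |L′|.
F^-potential : ∀ n (a : Node ℕ) →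
  proj₂ (F^ A n a) + length (proj₁ a) ≡ n + (proj₂ a + length (proj₁ (F^ A n a)))
F^-potential zero    a = refl
F^-potential (suc n) a with F^ A n a | F^-potential n a
... | j ∷ L , c | ih = trans ih (trans (cong (λ m → n + m) (ℕ.+-suc (proj₂ a) (length L))) (ℕ.+-suc n _))
... | []    , c | ih = cong suc ih

A-acyclic : ∀ n a → F^ A (suc n) a ≢ a
A-acyclic n a loop = ℕ.m≢1+n+m _ {n} (begin
  proj₂ a + length (proj₁ a)                          ≡⟨ cong (λ a′ → proj₂ a′ + length (proj₁ a)) loop ⟨
  proj₂ (F^ A (suc n) a) + length (proj₁ a)           ≡⟨ F^-potential (suc n) a ⟩
  suc n + (proj₂ a + length (proj₁ (F^ A (suc n) a))) ≡⟨ cong (λ a′ → suc n + level a′) loop ⟩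
  suc n + (proj₂ a + length (proj₁ a))                ∎)
  where
  open ≡-Reasoning
  level : Node ℕ → ℕ
  level a′ = proj₂ a + length (proj₁ a′)

F^-to-chain : ∀ d L b → F^ A (d + length L) (L , b) ≡ ([] , d + b)
F^-to-chain d L b = begin
  F^ A (d + length L) (L , b)       ≡⟨ F^-+ A d (length L) (L , b) ⟨
  F^ A d (F^ A (length L) (L , b))  ≡⟨ cong (F^ A d) (to-chain L) ⟩
  F^ A d ([] , b)                   ≡⟨ climb d ⟩
  ([] , d + b)                      ∎
  where
  open ≡-Reasoning
  to-chain : ∀ L → F^ A (length L) (L , b) ≡ ([] , b)
  to-chain []      = refl
  to-chain (j ∷ L) = trans (sym (F^-suc A (length L) (j ∷ L , b))) (to-chain L)
  climb : ∀ d → F^ A d ([] , b) ≡ ([] , d + b)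
  climb zero    = refl
  climb (suc d) = cong (up suc) (climb d)

A-satisfies : ∀ ax (a b : Node ℕ) → Witnessed A (body ax) a b
A-satisfies (f-undoes-k j) a b = 0 , a , refl
A-satisfies (k-disjoint i d) a b =
  0 , a , λ p → ℕ.m≢1+m+n i (proj₁ (List.∷-injective (cong proj₁ p)))
A-satisfies (f-acyclic n) a b =
  0 , a , λ p → A-acyclic n a (trans (sym (eval-f′^ A (suc n) x (a ∷ a ∷ b ∷ []))) p)
A-satisfies (f-keeps-kfree j) (i ∷ L , c) b = suc i , (L , c) , refl
A-satisfies (f-keeps-kfree j) ([] , c)    b = 0 , b , λ ()
A-satisfies f-injective-free (i ∷ L , c) b = suc i , (L , c) , inj₁ refl
A-satisfies f-injective-free ([] , c) (i ∷ L , c′) = suc i , (L , c′) , inj₂ refl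
A-satisfies f-injective-free ([] , c) ([] , c′) with c ℕ.≟ c′
... | yes refl = 0 , ([] , c) , inj₁ refl
... | no c≢c′  = 0 , ([] , c) , inj₂ (λ p → c≢c′ (ℕ.suc-injective (cong proj₂ p)))
A-satisfies connected (L , c) (L′ , c′) =
  pair p q , (L , c) , subst (λ r → satQF Sig A (meet r) ((L , c) ∷ (L , c) ∷ (L′ , c′) ∷ []))
                             (sym (unpair-pair p q)) meets
  where
  open ≡-Reasoning
  p q : ℕ
  p = c′ + length L
  q = c + length L′
  meets : eval Sig A (f′^ p x) ((L , c) ∷ (L , c) ∷ (L′ , c′) ∷ [])
        ≡ eval Sig A (f′^ q y) ((L , c) ∷ (L , c) ∷ (L′ , c′) ∷ [])
  meets = begin
    eval Sig A (f′^ p x) _   ≡⟨ eval-f′^ A p x _ ⟩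
    F^ A p (L , c)           ≡⟨ F^-to-chain c′ L c ⟩
    ([] , c′ + c)            ≡⟨ cong ([] ,_) (ℕ.+-comm c′ c) ⟩
    ([] , c + c′)            ≡⟨ F^-to-chain c L′ c′ ⟨
    F^ A q (L′ , c′)         ≡⟨ eval-f′^ A q y _ ⟨
    eval Sig A (f′^ q y) _   ∎

A⊨ψ : _⊨d_ Sig A ψ
A⊨ψ = (0 , refl , root ∷ [] , λ { j _ ((L , c) ∷ []) () }) ,
      (λ { n _ (a ∷ b ∷ []) → ∃w⋁-intro A (body (decode n)) a b (A-satisfies (decode n) a b) })

module ModelOfψ (em : ExcludedMiddle 0ℓ) (N : Structure Sig) (N⊨ψ : _⊨d_ Sig N ψ) where
  open Structure N

  axiom : ∀ ax a b → Witnessed N (body ax) a b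
  axiom ax a b = ∃w⋁-elim N (body ax) a b
    (subst (λ ax′ → satΣ Sig N (∃w⋁ (body ax′)) (a ∷ b ∷ [])) (decode-code ax)
           (proj₂ N⊨ψ (code ax) refl (a ∷ b ∷ [])))

  KFree : Carrier → Set
  KFree a = ∀ j b → K N j b ≢ a

  F-K : ∀ j a → F N (K N j a) ≡ a
  F-K j a = proj₂ (proj₂ (axiom (f-undoes-k j) a a))

  K-disjoint : ∀ {i j} a b → i ≢ j → K N i a ≢ K N j b
  K-disjoint {i} {j} a b i≢j with ℕ.<-cmp i j
  ... | tri< i<j _ _ = let (d , i+d) = ℕ.m≤n⇒∃[o]m+o≡n i<j in
        subst (λ j′ → K N i a ≢ K N j′ b) i+d (proj₂ (proj₂ (axiom (k-disjoint i d) a b)))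
  ... | tri≈ _ i≡j _ = ⊥-elim (i≢j i≡j)
  ... | tri> _ _ j<i = let (d , j+d) = ℕ.m≤n⇒∃[o]m+o≡n j<i in
        λ p → subst (λ i′ → K N j b ≢ K N i′ a) j+d
                    (proj₂ (proj₂ (axiom (k-disjoint j d) b a))) (sym p)

  F-acyclic : ∀ n a → F^ N (suc n) a ≢ a
  F-acyclic n a loop =
    proj₂ (proj₂ (axiom (f-acyclic n) a a)) (trans (eval-f′^ N (suc n) x _) loop)

  F-keeps-KFree : ∀ a → KFree a → KFree (F N a)
  F-keeps-KFree a free j b with axiom (f-keeps-kfree j) a b
  ... | zero  , _ , s = s
  ... | suc i , c , s = ⊥-elim (free i c s)

  F^-keeps-KFree : ∀ n a → KFree a → KFree (F^ N n a)
  F^-keeps-KFree zero    a free = free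
  F^-keeps-KFree (suc n) a free = F-keeps-KFree _ (F^-keeps-KFree n a free)

  F-injective-on-KFree : ∀ a b → KFree a → KFree b → F N a ≡ F N b → a ≡ b
  F-injective-on-KFree a b free-a free-b Fa≡Fb with axiom f-injective-free a b
  ... | zero  , _ , inj₁ a≡b   = a≡b
  ... | zero  , _ , inj₂ Fa≢Fb = ⊥-elim (Fa≢Fb Fa≡Fb)
  ... | suc i , c , inj₁ p     = ⊥-elim (free-a i c p)
  ... | suc i , c , inj₂ p     = ⊥-elim (free-b i c p)

  connect : ∀ a b → Σ[ p ∈ ℕ ] Σ[ q ∈ ℕ ] F^ N p a ≡ F^ N q b
  connect a b with axiom connected a b
  ... | n , c , s = proj₁ (unpair n) , proj₂ (unpair n) , read (unpair n) s
    where
    read : ∀ r → satQF Sig N (meet r) (c ∷ a ∷ b ∷ []) → F^ N (proj₁ r) a ≡ F^ N (proj₂ r) b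
    read (p , q) s′ = trans (sym (eval-f′^ N p x _)) (trans s′ (eval-f′^ N q y _))

  kfree-element : Σ[ z ∈ Carrier ] KFree z
  kfree-element with proj₁ N⊨ψ
  ... | _ , _ , z ∷ [] , s = z , λ j c → s j refl (c ∷ [])

  -- Every element hangs over a k-free root.  Excluded middle decides
  -- whether an element is in the image of some k j.
  descend : ∀ p a → KFree (F^ N p a) → Σ[ L ∈ List ℕ ] Σ[ z ∈ Carrier ] KFree z × a ≡ K* N L z
  descend zero    a free = [] , a , free , refl
  descend (suc p) a free with em {Σ[ j ∈ ℕ ] Σ[ b ∈ Carrier ] K N j b ≡ a}
  ... | no  ¬branch = [] , a , (λ j b p → ¬branch (j , b , p)) , refl
  ... | yes (j , b , refl) =
    let (L , z , free-z , b≡) = descend p b (subst KFree below free)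
    in j ∷ L , z , free-z , cong (K N j) b≡
    where
    below : F^ N (suc p) (K N j b) ≡ F^ N p b
    below = trans (sym (F^-suc N p (K N j b))) (cong (F^ N p) (F-K j b))

  hangs-over-kfree : ∀ a → Σ[ L ∈ List ℕ ] Σ[ z ∈ Carrier ] KFree z × a ≡ K* N L z
  hangs-over-kfree a =
    let (z , free-z) = kfree-element
        (p , q , meets) = connect a z
    in descend p a (subst KFree (sym meets) (F^-keeps-KFree q z free-z))

  aligned : ∀ p q u u′ → KFree u → KFree u′ → F^ N p u ≡ F^ N q u′ →
            (Σ[ d ∈ ℕ ] u′ ≡ F^ N d u) ⊎ (Σ[ d ∈ ℕ ] u ≡ F^ N d u′)
  aligned zero    q       u u′ _ _ meets = inj₂ (q , meets)
  aligned (suc p) zero    u u′ _ _ meets = inj₁ (suc p , sym meets)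
  aligned (suc p) (suc q) u u′ free free′ meets =
    aligned p q u u′ free free′
      (F-injective-on-KFree _ _ (F^-keeps-KFree p u free) (F^-keeps-KFree q u′ free′) meets)

  comparable : ∀ u u′ → KFree u → KFree u′ →
               (Σ[ d ∈ ℕ ] u′ ≡ F^ N d u) ⊎ (Σ[ d ∈ ℕ ] u ≡ F^ N d u′)
  comparable u u′ free free′ =
    let (p , q , meets) = connect u u′ in aligned p q u u′ free free′ meets

  F^-injective : ∀ {z} → KFree z → ∀ d d′ → F^ N d z ≡ F^ N d′ z → d ≡ d′
  F^-injective free zero    zero     _ = refl
  F^-injective free zero    (suc d′) p = ⊥-elim (F-acyclic d′ _ (sym p))
  F^-injective free (suc d) zero     p = ⊥-elim (F-acyclic d _ p)
  F^-injective free (suc d) (suc d′) p = cong suc (F^-injective free d d′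
    (F-injective-on-KFree _ _ (F^-keeps-KFree d _ free) (F^-keeps-KFree d′ _ free) p))

  place : Carrier → Node ℕ → Carrier
  place z (L , d) = K* N L (F^ N d z)

  place-hom : Carrier → Hom A N
  place-hom z = mkHom (place z) commute (λ j a → refl)
    where
    commute : ∀ a → place z (up suc a) ≡ F N (place z a)
    commute (j ∷ L , d) = sym (F-K j _)
    commute ([]    , d) = refl

  place-injective : ∀ {z} → KFree z → Injective _≡_ _≡_ (place z)
  place-injective {z} free {L , d} {L′ , d′} = on-branches L L′
    where
    on-branches : ∀ L L′ → place z (L , d) ≡ place z (L′ , d′) → (L , d) ≡ (L′ , d′)
    on-branches []      []        p = cong ([] ,_) (F^-injective free d d′ p)
    on-branches []      (j′ ∷ L′) p = ⊥-elim (F^-keeps-KFree d z free j′ _ (sym p))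
    on-branches (j ∷ L) []        p = ⊥-elim (F^-keeps-KFree d′ z free j _ p)
    on-branches (j ∷ L) (j′ ∷ L′) p with j ℕ.≟ j′
    ... | no  j≢j′ = ⊥-elim (K-disjoint _ _ j≢j′ p)
    ... | yes refl =
      cong (λ (L″ , d″) → j ∷ L″ , d″)
           (on-branches L L′ (trans (sym (F-K j _)) (trans (cong (F N) p) (F-K j _))))

  lower-root : ∀ {z z′} d → z ≡ F^ N d z′ → ∀ a →
               place z′ (proj₁ a , proj₂ a + d) ≡ place z a
  lower-root {z} {z′} d z≡ (L , e) =
    cong (K* N L) (trans (sym (F^-+ N e d z′)) (cong (F^ N e) (sym z≡)))

  common-root : ∀ {k} (g : Vec Carrier k) →
    Σ[ z ∈ Carrier ] KFree z × Σ[ a ∈ Vec (Node ℕ) k ] map (place z) a ≡ g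
  common-root [] = proj₁ kfree-element , proj₂ kfree-element , [] , refl
  common-root (b ∷ g) with common-root g | hangs-over-kfree b
  ... | z , free-z , a , a↦g | L , u , free-u , b≡ with comparable u z free-u free-z
  ...   | inj₁ (d , z≡) =
    u , free-u , (L , 0) ∷ map (λ (L′ , e) → L′ , e + d) a ,
    cong₂ _∷_ (sym b≡) (trans (sym (Vec.map-∘ (place u) _ a))
                              (trans (Vec.map-cong (lower-root d z≡) a) a↦g))
  ...   | inj₂ (d , u≡) =
    z , free-z , (L , d) ∷ a , cong₂ _∷_ (trans (cong (K* N L) (sym u≡)) (sym b≡)) a↦g

  ≅A : FinitelyGenerated Sig N → _≅_ Sig N A
  ≅A (k , g , generates) =
    let (z , free-z , a , a↦g) = common-root g
    in bijective-hom⇒≅ (place-hom z) (place-injective free-z)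
                       (onto-generators (place-hom z) g generates (a , a↦g))

-- ψ is a d-Σ₂ quasi Scott sentence for A (excluded middle is used to find
-- the k-free root below an element).
ψ-quasi-Scott : ExcludedMiddle 0ℓ → IsQuasiScottSentence Sig A ψ
ψ-quasi-Scott em = A⊨ψ , λ N fg N⊨ψ → ModelOfψ.≅A em N N⊨ψ fg

theorem5p14 : ExcludedMiddle 0ℓ →
    Σ[ L ∈ Signature ] Σ[ A ∈ Structure L ]
      (FinitelyGenerated L A
       × ¬ (Σ[ φ ∈ DSigmaSentence L 2 ] IsScottSentence L A φ)
       × Σ[ ψ ∈ DSigmaSentence L 2 ] IsQuasiScottSentence L A ψ)
theorem5p14 em = Sig , A , A-fg , A-no-dΣ₂-Scott-sentence , ψ , ψ-quasi-Scott em
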